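{- Let $k\ge 2$. If $G$ is a graph admitting a closed neighborhood balanced $k$-coloring and $H$ is any graph, then the strong product $G\boxtimes H$ admits a closed neighborhood balanced $k$-coloring.
   Context: All graphs are finite and simple with nonempty vertex sets. $N[v]$ is the closed neighborhood of $v$. A closed neighborhood balanced $k$-coloring of a graph is a map $c$ from its vertex set to $\{1,\dots,k\}$ such that for every vertex $v$ the numbers $|N[v]\cap c^{ -1}(i)|$, $i=1,\dots,k$, are all equal. The strong product $G\boxtimes H$ has vertex set $V(G)\times V(H)$, with $(g,h)$ and $(g',h')$ adjacent iff ($g=g'$ and $hh'\in E(H)$) or ($h=h'$ and $gg'\in E(G)$) or ($gg'\in E(G)$ and $hh'\in E(H)$). -}

module Defs where

open import Data.Nat using (ℕ; suc; _*_; NonZero)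
open import Data.Fin using (Fin; combine; remQuot)
open import Data.Bool using (Bool; true; false; _∧_; _∨_)
open import Data.Product using (_×_; proj₁; proj₂)
open import Data.List using (List; filter; length)
open import Data.List using () renaming (allFin to allFinL)
open import Data.Fin.Properties using (_≟_)
open import Relation.Nullary.Decidable using (does; ⌊_⌋)
open import Relation.Binary.PropositionalEquality using (_≡_; refl)
import Relation.Binary.PropositionalEquality as ≡
open import Relation.Nullary using (yes; no)
open import Data.Empty using (⊥-elim)
open import Relation.Unary using (Pred)

record Graph : Set where
  field
    size     : ℕ
    nonEmpty : NonZero size
    adj      : Fin size → Fin size → Bool
    sym      : ∀ u v → adj u v ≡ adj v u
    irrefl   : ∀ v → adj v v ≡ false

open Graph public

inClosedNbhd : (G : Graph) → Fin (size G) → Fin (size G) → Bool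
inClosedNbhd G v u = ⌊ u ≟ v ⌋ ∨ adj G v u

countColor : (G : Graph) {k : ℕ} → (Fin (size G) → Fin k) → Fin (size G) → Fin k → ℕ
countColor G c v i =
  length (filter (λ u → Data.Bool.T? (inClosedNbhd G v u ∧ ⌊ c u ≟ i ⌋)) (allFinL (size G)))
  where import Data.Bool

-- closed neighbourhood balanced k-coloring (colors Fin k stand for {1,…,k})
IsCNBColoring : (G : Graph) (k : ℕ) → (Fin (size G) → Fin k) → Set
IsCNBColoring G k c = ∀ v i j → countColor G c v i ≡ countColor G c v j

record HasCNBColoring (G : Graph) (k : ℕ) : Set where
  field
    coloring : Fin (size G) → Fin k
    balanced : IsCNBColoring G k coloring

-- strong product: vertex (g,h) encoded as combine g h : Fin (|G| * |H|)
private
  nz* : ∀ m n → NonZero m → NonZero n → NonZero (m * n)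
  nz* (suc m) (suc n) _ _ = _

  eqF : ∀ {n} → Fin n → Fin n → Bool
  eqF a b = ⌊ a ≟ b ⌋

strongAdj : (G H : Graph) → Fin (size G * size H) → Fin (size G * size H) → Bool
strongAdj G H x y =
  (eqF gx gy ∧ adj H hx hy) ∨ (eqF hx hy ∧ adj G gx gy) ∨ (adj G gx gy ∧ adj H hx hy)
  where
  gx = proj₁ (remQuot {size G} (size H) x)
  hx = proj₂ (remQuot {size G} (size H) x)
  gy = proj₁ (remQuot {size G} (size H) y)
  hy = proj₂ (remQuot {size G} (size H) y)

private
  eqF-sym : ∀ {n} (a b : Fin n) → eqF a b ≡ eqF b a
  eqF-sym a b with a ≟ b | b ≟ a
  ... | yes _ | yes _ = refl
  ... | no _ | no _ = refl
  ... | yes p | no q = ⊥-elim (q (≡.sym p))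
  ... | no p | yes q = ⊥-elim (p (≡.sym q))

  ∧-false : ∀ b → b ∧ false ≡ false
  ∧-false true = refl
  ∧-false false = refl

strongSym : (G H : Graph) → ∀ x y → strongAdj G H x y ≡ strongAdj G H y x
strongSym G H x y
  rewrite eqF-sym (proj₁ (remQuot {size G} (size H) x)) (proj₁ (remQuot {size G} (size H) y))
        | eqF-sym (proj₂ (remQuot {size G} (size H) x)) (proj₂ (remQuot {size G} (size H) y))
        | sym H (proj₂ (remQuot {size G} (size H) x)) (proj₂ (remQuot {size G} (size H) y))
        | sym G (proj₁ (remQuot {size G} (size H) x)) (proj₁ (remQuot {size G} (size H) y))
  = refl

strongIrrefl : (G H : Graph) → ∀ x → strongAdj G H x x ≡ false
strongIrrefl G H x
  rewrite irrefl H (proj₂ (remQuot {size G} (size H) x))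
        | irrefl G (proj₁ (remQuot {size G} (size H) x))
        | ∧-false (eqF (proj₁ (remQuot {size G} (size H) x)) (proj₁ (remQuot {size G} (size H) x)))
        | ∧-false (eqF (proj₂ (remQuot {size G} (size H) x)) (proj₂ (remQuot {size G} (size H) x)))
  = refl

_⊠_ : Graph → Graph → Graph
G ⊠ H = record
  { size     = size G * size H
  ; nonEmpty = nz* (size G) (size H) (nonEmpty G) (nonEmpty H)
  ; adj      = strongAdj G H
  ; sym      = strongSym G H
  ; irrefl   = strongIrrefl G H
  }

-- Colour each vertex (g , h) of G ⊠ H by the colour of g. The closed neighbourhood of (g , h) is
-- N[g] × N[h], so the number of vertices of colour i in it is |N[g] ∩ c⁻¹(i)| · |N[h]|, which is
-- independent of i because c is balanced on G.
module Submission where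

open import Defs hiding (sym)
open import Data.Nat using (ℕ; zero; suc; _+_; _*_; _≥_)
open import Data.Fin using (Fin; zero; suc; _↑ˡ_; _↑ʳ_; remQuot; combine)
open import Data.Fin.Properties using (_≟_; splitAt-↑ʳ; remQuot-combine; combine-remQuot)
open import Data.Bool using (Bool; true; false; _∧_; _∨_; if_then_else_; T?)
open import Data.Bool.Properties
  using (∧-comm; ∨-assoc; ∧-distribˡ-∨; ∧-distribʳ-∨; ∧-commutativeMonoid)
open import Algebra.Bundles using (CommutativeMonoid)
open import Algebra.Properties.CommutativeSemigroup (CommutativeMonoid.commutativeSemigroup ∧-commutativeMonoid)
  using (xy∙z≈xz∙y)
open import Data.Product using (_×_; _,_; proj₁; proj₂)
open import Data.List using (filter; length; tabulate)
open import Data.Nat.Properties using (+-assoc)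
open import Relation.Nullary using (Dec)
open import Relation.Nullary.Decidable using (⌊_⌋; isYes≗does; does-⇔; _×-dec_)
open import Relation.Binary.PropositionalEquality
open import Function using (_∘_; _⇔_; mk⇔)

count : ∀ {n} → (Fin n → Bool) → ℕ
count {zero}  P = 0
count {suc n} P = (if P zero then 1 else 0) + count (P ∘ suc)

count-cong : ∀ {n} {P Q : Fin n → Bool} → (∀ x → P x ≡ Q x) → count P ≡ count Q
count-cong {zero}  P≗Q = refl
count-cong {suc n} P≗Q = cong₂ _+_ (cong (λ b → if b then 1 else 0) (P≗Q zero)) (count-cong (P≗Q ∘ suc))

length-filter-tabulate : ∀ {A : Set} n (f : Fin n → A) (P : A → Bool) →
                         length (filter (T? ∘ P) (tabulate f)) ≡ count (P ∘ f)
length-filter-tabulate zero    f P = refl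
length-filter-tabulate (suc n) f P with P (f zero)
... | true  = cong suc (length-filter-tabulate n (f ∘ suc) P)
... | false = length-filter-tabulate n (f ∘ suc) P

count-++ : ∀ m n (P : Fin (m + n) → Bool) → count P ≡ count (P ∘ (_↑ˡ n)) + count (P ∘ (m ↑ʳ_))
count-++ zero    n P = refl
count-++ (suc m) n P = trans (cong (head +_) (count-++ m n (P ∘ suc)))
                             (sym (+-assoc head _ _))
  where head = if P zero then 1 else 0

count-false : ∀ n → count {n} (λ _ → false) ≡ 0
count-false zero    = refl
count-false (suc n) = count-false n

count-∧ˡ : ∀ {n} a (P : Fin n → Bool) → count (λ j → a ∧ P j) ≡ (if a then count P else 0)
count-∧ˡ true  P = refl
count-∧ˡ {n} false P = count-false n

remQuot-↑ʳ : ∀ m n (x : Fin (m * n)) →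
             remQuot {suc m} n (n ↑ʳ x) ≡ (suc (proj₁ (remQuot {m} n x)) , proj₂ (remQuot {m} n x))
remQuot-↑ʳ m n x rewrite splitAt-↑ʳ n (m * n) x = refl

count-remQuot-∧ : ∀ m n (P : Fin m → Bool) (Q : Fin n → Bool) →
                  count (λ x → P (proj₁ (remQuot {m} n x)) ∧ Q (proj₂ (remQuot {m} n x)))
                    ≡ count P * count Q
count-remQuot-∧ zero    n P Q = refl
count-remQuot-∧ (suc m) n P Q = begin
  count R
    ≡⟨ count-++ n (m * n) R ⟩
  count (R ∘ (_↑ˡ m * n)) + count (R ∘ (n ↑ʳ_))
    ≡⟨ cong₂ _+_ (count-cong (cong P×Q ∘ remQuot-combine {suc m} zero))
                 (count-cong (cong P×Q ∘ remQuot-↑ʳ m n)) ⟩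
  count (λ j → P zero ∧ Q j) + count (λ x → P (suc (proj₁ (remQuot {m} n x))) ∧ Q (proj₂ (remQuot {m} n x)))
    ≡⟨ cong₂ _+_ (count-∧ˡ (P zero) Q) (count-remQuot-∧ m n (P ∘ suc) Q) ⟩
  (if P zero then count Q else 0) + count (P ∘ suc) * count Q
    ≡⟨ if-+-distrib (P zero) ⟩
  count P * count Q ∎
  where
  open ≡-Reasoning
  P×Q : Fin (suc m) × Fin n → Bool
  P×Q (g , h) = P g ∧ Q h
  R : Fin (suc m * n) → Bool
  R = P×Q ∘ remQuot n
  if-+-distrib : ∀ b → (if b then count Q else 0) + count (P ∘ suc) * count Q
                       ≡ ((if b then 1 else 0) + count (P ∘ suc)) * count Q
  if-+-distrib true  = refl
  if-+-distrib false = refl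

⌊⌋-⇔ : ∀ {A B : Set} → A ⇔ B → (a? : Dec A) (b? : Dec B) → ⌊ a? ⌋ ≡ ⌊ b? ⌋
⌊⌋-⇔ A⇔B a? b? = trans (isYes≗does a?) (trans (does-⇔ A⇔B a? b?) (sym (isYes≗does b?)))

⌊⌋-×-dec : ∀ {A B : Set} (a? : Dec A) (b? : Dec B) → ⌊ a? ×-dec b? ⌋ ≡ ⌊ a? ⌋ ∧ ⌊ b? ⌋
⌊⌋-×-dec a? b? = trans (isYes≗does (a? ×-dec b?))
                        (sym (cong₂ _∧_ (isYes≗does a?) (isYes≗does b?)))

≟-sym : ∀ {n} (a b : Fin n) → ⌊ a ≟ b ⌋ ≡ ⌊ b ≟ a ⌋
≟-sym a b = ⌊⌋-⇔ (mk⇔ sym sym) (a ≟ b) (b ≟ a)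

remQuot-≟ : ∀ m n (x y : Fin (m * n)) →
            ⌊ x ≟ y ⌋ ≡ ⌊ proj₁ (remQuot {m} n x) ≟ proj₁ (remQuot {m} n y) ⌋
                      ∧ ⌊ proj₂ (remQuot {m} n x) ≟ proj₂ (remQuot {m} n y) ⌋
remQuot-≟ m n x y = trans (⌊⌋-⇔ (mk⇔ to from) (x ≟ y) (g ≟ g′ ×-dec h ≟ h′)) (⌊⌋-×-dec (g ≟ g′) (h ≟ h′))
  where
  g = proj₁ (remQuot {m} n x)
  h = proj₂ (remQuot {m} n x)
  g′ = proj₁ (remQuot {m} n y)
  h′ = proj₂ (remQuot {m} n y)
  to : x ≡ y → g ≡ g′ × h ≡ h′
  to refl = refl , refl
  from : g ≡ g′ × h ≡ h′ → x ≡ y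
  from (g≡g′ , h≡h′) = begin
    x               ≡⟨ combine-remQuot {m} n x ⟨
    combine g h     ≡⟨ cong₂ combine g≡g′ h≡h′ ⟩
    combine g′ h′   ≡⟨ combine-remQuot {m} n y ⟩
    y               ∎
    where open ≡-Reasoning

∧-∨-expand : ∀ a b p q → (a ∧ b) ∨ (a ∧ q) ∨ (b ∧ p) ∨ (p ∧ q) ≡ (a ∨ p) ∧ (b ∨ q)
∧-∨-expand a b p q = sym (begin
  (a ∨ p) ∧ (b ∨ q)                           ≡⟨ ∧-distribʳ-∨ (b ∨ q) a p ⟩
  (a ∧ (b ∨ q)) ∨ (p ∧ (b ∨ q))               ≡⟨ cong₂ _∨_ (∧-distribˡ-∨ a b q) (∧-distribˡ-∨ p b q) ⟩
  ((a ∧ b) ∨ (a ∧ q)) ∨ ((p ∧ b) ∨ (p ∧ q))   ≡⟨ ∨-assoc (a ∧ b) (a ∧ q) _ ⟩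
  (a ∧ b) ∨ (a ∧ q) ∨ (p ∧ b) ∨ (p ∧ q)       ≡⟨ cong (λ r → (a ∧ b) ∨ (a ∧ q) ∨ r ∨ (p ∧ q)) (∧-comm p b) ⟩
  (a ∧ b) ∨ (a ∧ q) ∨ (b ∧ p) ∨ (p ∧ q)       ∎)
  where open ≡-Reasoning

module _ (G H : Graph) where

  π₁ : Fin (size (G ⊠ H)) → Fin (size G)
  π₁ = proj₁ ∘ remQuot {size G} (size H)

  π₂ : Fin (size (G ⊠ H)) → Fin (size H)
  π₂ = proj₂ ∘ remQuot {size G} (size H)

  inClosedNbhd-⊠ : ∀ x y → inClosedNbhd (G ⊠ H) x y
                           ≡ inClosedNbhd G (π₁ x) (π₁ y) ∧ inClosedNbhd H (π₂ x) (π₂ y)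
  inClosedNbhd-⊠ x y
    rewrite remQuot-≟ (size G) (size H) y x | ≟-sym (π₁ x) (π₁ y) | ≟-sym (π₂ x) (π₂ y)
    = ∧-∨-expand ⌊ π₁ y ≟ π₁ x ⌋ ⌊ π₂ y ≟ π₂ x ⌋ (adj G (π₁ x) (π₁ y)) (adj H (π₂ x) (π₂ y))

  countColor-⊠ : ∀ {k} (c : Fin (size G) → Fin k) x i →
                 countColor (G ⊠ H) (c ∘ π₁) x i ≡ countColor G c (π₁ x) i * count (inClosedNbhd H (π₂ x))
  countColor-⊠ c x i = begin
    countColor (G ⊠ H) (c ∘ π₁) x i
      ≡⟨ length-filter-tabulate (size (G ⊠ H)) (λ y → y) (λ y → inClosedNbhd (G ⊠ H) x y ∧ ⌊ c (π₁ y) ≟ i ⌋) ⟩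
    count (λ y → inClosedNbhd (G ⊠ H) x y ∧ ⌊ c (π₁ y) ≟ i ⌋)
      ≡⟨ count-cong split ⟩
    count (λ y → inColor (π₁ y) ∧ inClosedNbhd H (π₂ x) (π₂ y))
      ≡⟨ count-remQuot-∧ (size G) (size H) inColor (inClosedNbhd H (π₂ x)) ⟩
    count inColor * count (inClosedNbhd H (π₂ x))
      ≡⟨ cong (_* _) (length-filter-tabulate (size G) (λ g → g) inColor) ⟨
    countColor G c (π₁ x) i * count (inClosedNbhd H (π₂ x)) ∎
    where
    open ≡-Reasoning
    inColor : Fin (size G) → Bool
    inColor g = inClosedNbhd G (π₁ x) g ∧ ⌊ c g ≟ i ⌋
    split : ∀ y → inClosedNbhd (G ⊠ H) x y ∧ ⌊ c (π₁ y) ≟ i ⌋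
                ≡ inColor (π₁ y) ∧ inClosedNbhd H (π₂ x) (π₂ y)
    split y = trans (cong (_∧ ⌊ c (π₁ y) ≟ i ⌋) (inClosedNbhd-⊠ x y))
                    (xy∙z≈xz∙y (inClosedNbhd G (π₁ x) (π₁ y)) (inClosedNbhd H (π₂ x) (π₂ y)) ⌊ c (π₁ y) ≟ i ⌋)

  ⊠-preservesCNBColoring : ∀ {k} → HasCNBColoring G k → HasCNBColoring (G ⊠ H) k
  ⊠-preservesCNBColoring {k} χ = record { coloring = c ∘ π₁ ; balanced = balanced }
    where
    open HasCNBColoring χ renaming (coloring to c; balanced to c-balanced)
    balanced : IsCNBColoring (G ⊠ H) k (c ∘ π₁)
    balanced x i j = begin
      countColor (G ⊠ H) (c ∘ π₁) x i                         ≡⟨ countColor-⊠ c x i ⟩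
      countColor G c (π₁ x) i * count (inClosedNbhd H (π₂ x))  ≡⟨ cong (_* _) (c-balanced (π₁ x) i j) ⟩
      countColor G c (π₁ x) j * count (inClosedNbhd H (π₂ x))  ≡⟨ countColor-⊠ c x j ⟨
      countColor (G ⊠ H) (c ∘ π₁) x j                         ∎
      where open ≡-Reasoning

theorem2p18 : (k : ℕ) → k ≥ 2 → (G H : Graph) → HasCNBColoring G k → HasCNBColoring (G ⊠ H) k
theorem2p18 k _ G H = ⊠-preservesCNBColoring G H
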